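{- Let $\mathbb D$ be a block design with parameters $(v,b,r,k,\lambda)$ with $k=3$, built on a finite set $V$. For $S\subseteq V$ let $\varphi(\mathbb D,S)$ be as in the context. (i) The $3$-element subsets $S$ of $V$ fall into two classes according to the value of $\varphi(\mathbb D,S)$, namely $D^{(3)}_1=\mathbb D$ (the blocks of $\mathbb D$) and $D^{(3)}_2$ (the set of all $3$-subsets of $V$ that are not blocks of $\mathbb D$). Both $D^{(3)}_1$ and $D^{(3)}_2$ are block designs, and both are friends with $\mathbb D$. (ii) If moreover $\lambda=1$, the $4$-element subsets $T$ of $V$ fall into two classes according to the value of $\varphi(\mathbb D,T)$, namely $D^{(4)}_1$ (the $4$-subsets of $V$ containing at least one block of $\mathbb D$) and $D^{(4)}_2$ (the $4$-subsets of $V$ containing no block of $\mathbb D$). Both $D^{(4)}_1$ and $D^{(4)}_2$ are block designs, and both are friends with $\mathbb D$.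
   Context: A block design with parameters $(v,b,r,k,\lambda)$ built on a finite set $V$ ($|V|=v$) is a list of $b$ blocks, each a $k$-subset of $V$, such that every element lies in exactly $r$ blocks and every pair of distinct elements lies in exactly $\lambda$ blocks; designs are simple (no repeated blocks). For a design $D$ with blocks $B_1,\dots,B_b$ of size $k$ and $M\subseteq V$, $\varphi(D,M)=(z_0,\dots,z_k)$ where $z_j$ is the number of $s$ with $|M\cap B_s|=j$. Two designs $D_1,D_2$ on $V$ are friends if $\varphi(D_1,D_2^i)$ is independent of the block $D_2^i$ of $D_2$ and $\varphi(D_2,D_1^j)$ is independent of the block $D_1^j$ of $D_1$. The classes in question are the fibres of the map $S\mapsto\varphi(\mathbb D,S)$ on the set of all $n$-element subsets of $V$ (for $n=3$, resp. $n=4$). -}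

module Defs where

open import Data.Nat using (ℕ; zero; suc; _≟_)
open import Data.Bool using (Bool; true; false)
open import Data.Fin using (Fin; toℕ)
open import Data.Fin.Subset using (Subset; _∈_; _⊆_; _∩_; ∣_∣)
open import Data.Fin.Subset.Properties using (_∈?_; _⊆?_)
open import Data.List using (List; []; _∷_; _++_; map; filter; length)
open import Data.List.Relation.Unary.All using (All)
open import Data.List.Relation.Unary.Any using (Any; any?)
open import Data.List.Relation.Unary.Unique.Propositional using (Unique)
import Data.List.Membership.Propositional as Mem
open import Data.List.Membership.DecPropositional using ()
open import Data.Vec using (Vec; []; _∷_; tabulate)
import Data.Vec.Properties as VecP
import Data.Bool.Properties as BoolP
open import Data.Product using (Σ; ∃; _×_)
open import Relation.Nullary using (¬_; Dec)
open import Relation.Nullary.Decidable using (¬?)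
open import Relation.Binary.PropositionalEquality using (_≡_; _≢_)

-- The point set V is Fin v; subsets of V are Data.Fin.Subset (Vec Bool v).
-- A design is a list of blocks (subsets of Fin v).

countIn : ∀ {v} → Fin v → List (Subset v) → ℕ
countIn x D = length (filter (x ∈?_) D)

countIn₂ : ∀ {v} → Fin v → Fin v → List (Subset v) → ℕ
countIn₂ x y D = length (filter (x ∈?_) (filter (y ∈?_) D))

record IsBlockDesign (v b r k lam : ℕ) (D : List (Subset v)) : Set where
  field
    numBlocks  : length D ≡ b
    blockSize  : All (λ B → ∣ B ∣ ≡ k) D
    simple     : Unique D
    replicated : ∀ (x : Fin v) → countIn x D ≡ r
    balanced   : ∀ (x y : Fin v) → x ≢ y → countIn₂ x y D ≡ lam

IsDesign : (v k : ℕ) → List (Subset v) → Set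
IsDesign v k D = Σ ℕ λ b → Σ ℕ λ r → Σ ℕ λ lam → IsBlockDesign v b r k lam D

φ : ∀ {v} (k : ℕ) → List (Subset v) → Subset v → Vec ℕ (suc k)
φ k D M = tabulate (λ (j : Fin (suc k)) → length (filter (λ B → ∣ M ∩ B ∣ ≟ toℕ j) D))

Friends : ∀ {v} (k₁ k₂ : ℕ) → List (Subset v) → List (Subset v) → Set
Friends k₁ k₂ D₁ D₂ =
  (∀ B B′ → B Mem.∈ D₂ → B′ Mem.∈ D₂ → φ k₁ D₁ B ≡ φ k₁ D₁ B′) ×
  (∀ A A′ → A Mem.∈ D₁ → A′ Mem.∈ D₁ → φ k₂ D₂ A ≡ φ k₂ D₂ A′)

allSubsets : (n : ℕ) → List (Subset n)
allSubsets zero = [] ∷ []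
allSubsets (suc n) = map (true ∷_) (allSubsets n) ++ map (false ∷_) (allSubsets n)

kSubsets : (n k : ℕ) → List (Subset n)
kSubsets n k = filter (λ S → ∣ S ∣ ≟ k) (allSubsets n)

private
  _≟S_ : ∀ {n} (x y : Subset n) → Dec (x ≡ y)
  _≟S_ = VecP.≡-dec BoolP._≟_

D3₂ : ∀ {v} → List (Subset v) → List (Subset v)
D3₂ {v} D = filter (λ S → ¬? (Data.List.Membership.DecPropositional._∈?_ _≟S_ S D)) (kSubsets v 3)

D4₁ : ∀ {v} → List (Subset v) → List (Subset v)
D4₁ {v} D = filter (λ T → any? (λ B → B ⊆? T) D) (kSubsets v 4)

D4₂ : ∀ {v} → List (Subset v) → List (Subset v)
D4₂ {v} D = filter (λ T → ¬? (any? (λ B → B ⊆? T) D)) (kSubsets v 4)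

-- If M meets every block of a design in at most three points, its intersection profile
-- z_j = #{B : |M ∩ B| = j}, which is what φ records, obeys the moment equations
--   Σ z_j = b,   Σ j z_j = r |M|,   Σ (j choose 2) z_j = λ (|M| choose 2),
-- a triangular system: the profile is determined by |M| and z_3.  A 3-set has z_3 = 1 or 0 as it
-- is a block or not; if λ = 1, two blocks share at most one point, so a 4-set contains at most one
-- block and has z_3 = 1 or 0 as it contains one or not.  This gives the fibres and, applied to the
-- design on the other side, the friendships.  The new families are designs because they are regular:
-- the number of their blocks through a set of at most two points depends only on its size.  Designs
-- are regular, complements within the k-sets preserve regularity, and 4-sets containing a block are
-- counted block by block.
module Submission where

open import Defs
open import Data.Nat using (ℕ)
open import Data.Fin.Subset using (Subset; ∣_∣)
open import Data.List using (List)
open import Data.List.Membership.Propositional using (_∈_)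
open import Data.Product using (_×_)
open import Data.Sum using (_⊎_)
open import Function.Bundles using (_⇔_)
open import Relation.Binary.PropositionalEquality using (_≡_)

open import Level using (Level)
open import Data.Nat using (zero; suc; _+_; _*_; _∸_; _≤_; _<_; _≤?_; z≤n; s≤s)
  renaming (_≟_ to _≟ℕ_)
open import Data.Nat.Properties
open import Data.Nat.Combinatorics using (_C_; nCk+nC[k+1]≡[n+1]C[k+1]; nC1≡n)
open import Data.Nat.Tactic.RingSolver using (solve-∀)
open import Data.Bool using (Bool; true; false; _∧_; _∨_; not)
open import Data.Bool.Properties using (∧-zeroʳ; ∧-comm; ∧-assoc)
import Data.Bool.Properties as BoolP
open import Data.Fin using (Fin; zero; suc; toℕ; fromℕ)
open import Data.Fin.Subset using (_∩_; _∪_; ⁅_⁆; ⊥; _⊆_)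
open import Data.Fin.Subset.Properties
  using (_∈?_; _⊆?_; ⊥⊆; p⊆q⇒∣p∣≤∣q∣; ∣p∩q∣≤∣p∣; ∣p∩q∣≤∣q∣; ∣p∣≤n; ∣⁅x⁆∣≡1; ∣⊥∣≡0;
         ∩-zeroˡ; ∩-zeroʳ; ∩-comm; ∩-assoc; ∩-idem)
open import Data.Vec using ([]; _∷_; head; tail; tabulate; lookup)
import Data.Vec.Properties as VecP
import Data.Fin.Properties as FinP
open import Data.List using ([]; _∷_; _++_; map; filter; filterᵇ; length)
open import Data.List.Membership.Propositional using (_∉_; lose)
open import Data.List.Membership.Propositional.Properties
  using (∈-map⁺; ∈-map⁻; ∈-++⁺ˡ; ∈-++⁺ʳ; ∈-filter⁺; ∈-filter⁻)
import Data.List.Membership.DecPropositional as DecMembership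
open import Data.List.Relation.Unary.All as All using (All; []; _∷_)
open import Data.List.Relation.Unary.Any using (Any; here; there; any?)
open import Data.List.Relation.Unary.Unique.Propositional using (Unique)
import Data.List.Relation.Unary.Unique.Propositional.Properties as Unique
open import Data.List.Relation.Unary.AllPairs using ([]; _∷_)
open import Data.Product using (_,_; proj₁; proj₂)
open import Data.Sum using (inj₁; inj₂)
open import Function.Bundles using (mk⇔)
open import Data.Empty using (⊥-elim)
open import Relation.Nullary using (¬_; Dec; yes; no; does)
open import Relation.Nullary.Decidable using (¬?; T?; dec-true; dec-false)
open import Relation.Unary using (Pred; Decidable)
open import Relation.Binary.Definitions using (DecidableEquality)
open import Relation.Binary.PropositionalEquality
  using (refl; sym; trans; cong; cong₂; subst; subst₂; _≢_; ≢-sym; module ≡-Reasoning)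

⟦_⟧ : Bool → ℕ
⟦ true ⟧ = 1
⟦ false ⟧ = 0

⟦∧⟧ : ∀ a b → ⟦ a ∧ b ⟧ ≡ ⟦ a ⟧ * ⟦ b ⟧
⟦∧⟧ true b = sym (+-identityʳ ⟦ b ⟧)
⟦∧⟧ false b = refl

∑ : {A : Set} → (A → ℕ) → List A → ℕ
∑ g [] = 0
∑ g (x ∷ L) = g x + ∑ g L

syntax ∑ (λ x → e) L = ∑[ x ← L ] e

count : {A : Set} → (A → Bool) → List A → ℕ
count f L = ∑[ x ← L ] ⟦ f x ⟧

module _ {A : Set} where

  ∑-cong : {g h : A → ℕ} (L : List A) → (∀ x → g x ≡ h x) → ∑ g L ≡ ∑ h L
  ∑-cong [] e = refl
  ∑-cong (x ∷ L) e = cong₂ _+_ (e x) (∑-cong L e)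

  ∑-congᴬ : {g h : A → ℕ} {L : List A} → All (λ x → g x ≡ h x) L → ∑ g L ≡ ∑ h L
  ∑-congᴬ [] = refl
  ∑-congᴬ (e ∷ es) = cong₂ _+_ e (∑-congᴬ es)

  ∑-zero : (L : List A) → ∑[ x ← L ] 0 ≡ 0
  ∑-zero [] = refl
  ∑-zero (x ∷ L) = ∑-zero L

  ∑-+ : (g h : A → ℕ) (L : List A) → ∑[ x ← L ] (g x + h x) ≡ ∑ g L + ∑ h L
  ∑-+ g h [] = refl
  ∑-+ g h (x ∷ L) = trans (cong (g x + h x +_) (∑-+ g h L)) (interchange (g x) (h x) (∑ g L) (∑ h L))
    where
    interchange : ∀ a b c d → a + b + (c + d) ≡ a + c + (b + d)
    interchange = solve-∀

  ∑-++ : (g : A → ℕ) (L M : List A) → ∑ g (L ++ M) ≡ ∑ g L + ∑ g M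
  ∑-++ g [] M = refl
  ∑-++ g (x ∷ L) M = trans (cong (g x +_) (∑-++ g L M)) (sym (+-assoc (g x) (∑ g L) (∑ g M)))

  ∑-member : (g : A → ℕ) {x : A} (L : List A) → x ∈ L → g x ≤ ∑ g L
  ∑-member g (y ∷ L) (here refl) = m≤m+n (g y) (∑ g L)
  ∑-member g (y ∷ L) (there x∈L) = ≤-trans (∑-member g L x∈L) (m≤n+m (∑ g L) (g y))

  ∑-two-members : (g : A → ℕ) {x y : A} (L : List A) → x ∈ L → y ∈ L → x ≢ y → g x + g y ≤ ∑ g L
  ∑-two-members g (z ∷ L) (here refl) (here refl) x≢y = ⊥-elim (x≢y refl)
  ∑-two-members g (z ∷ L) (here refl) (there y∈L) _ = +-monoʳ-≤ (g z) (∑-member g L y∈L)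
  ∑-two-members g {x} (z ∷ L) (there x∈L) (here refl) _ =
    subst (_≤ g z + ∑ g L) (+-comm (g z) (g x)) (+-monoʳ-≤ (g z) (∑-member g L x∈L))
  ∑-two-members g (z ∷ L) (there x∈L) (there y∈L) x≢y =
    ≤-trans (∑-two-members g L x∈L y∈L x≢y) (m≤n+m (∑ g L) (g z))

  count-none : (f : A → Bool) (L : List A) → (∀ x → x ∈ L → f x ≡ false) → count f L ≡ 0
  count-none f [] _ = refl
  count-none f (x ∷ L) h = trans (cong (λ b → ⟦ b ⟧ + count f L) (h x (here refl)))
    (count-none f L (λ y y∈L → h y (there y∈L)))

  ∑-filter : {ℓ : Level} {P : Pred A ℓ} (P? : Decidable P) (g : A → ℕ) (L : List A) →
    ∑ g (filter P? L) ≡ ∑[ x ← L ] (⟦ does (P? x) ⟧ * g x)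
  ∑-filter P? g [] = refl
  ∑-filter P? g (x ∷ L) with does (P? x)
  ... | true = cong₂ _+_ (sym (+-identityʳ (g x))) (∑-filter P? g L)
  ... | false = ∑-filter P? g L

  count-filter : {ℓ : Level} {P : Pred A ℓ} (P? : Decidable P) (f : A → Bool) (L : List A) →
    count f (filter P? L) ≡ count (λ x → does (P? x) ∧ f x) L
  count-filter P? f L =
    trans (∑-filter P? (λ x → ⟦ f x ⟧) L) (∑-cong L (λ x → sym (⟦∧⟧ (does (P? x)) (f x))))

  length-filter : {ℓ : Level} {P : Pred A ℓ} (P? : Decidable P) (L : List A) →
    length (filter P? L) ≡ count (λ x → does (P? x)) L
  length-filter P? [] = refl
  length-filter P? (x ∷ L) with does (P? x)
  ... | true = cong suc (length-filter P? L)
  ... | false = length-filter P? L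

  count-split : {ℓ : Level} {P : Pred A ℓ} (P? : Decidable P) (f : A → Bool) (L : List A) →
    count f (filter (λ x → ¬? (P? x)) L) + count f (filter P? L) ≡ count f L
  count-split P? f L = begin
    count f (filter (λ x → ¬? (P? x)) L) + count f (filter P? L)
      ≡⟨ cong₂ _+_ (count-filter (λ x → ¬? (P? x)) f L) (count-filter P? f L) ⟩
    count (λ x → not (does (P? x)) ∧ f x) L + count (λ x → does (P? x) ∧ f x) L
      ≡⟨ sym (∑-+ _ _ L) ⟩
    ∑[ x ← L ] (⟦ not (does (P? x)) ∧ f x ⟧ + ⟦ does (P? x) ∧ f x ⟧)
      ≡⟨ ∑-cong L (λ x → split (does (P? x)) (f x)) ⟩
    count f L ∎
    where
    open ≡-Reasoning
    split : ∀ a b → ⟦ not a ∧ b ⟧ + ⟦ a ∧ b ⟧ ≡ ⟦ b ⟧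
    split true b = refl
    split false b = +-identityʳ ⟦ b ⟧

module _ {A B : Set} where

  ∑-map : (g : B → ℕ) (h : A → B) (L : List A) → ∑ g (map h L) ≡ ∑[ x ← L ] g (h x)
  ∑-map g h [] = refl
  ∑-map g h (x ∷ L) = cong (g (h x) +_) (∑-map g h L)

  ∑-swap : (f : A → B → ℕ) (L : List A) (M : List B) →
    ∑[ x ← L ] ∑[ y ← M ] f x y ≡ ∑[ y ← M ] ∑[ x ← L ] f x y
  ∑-swap f [] M = sym (∑-zero M)
  ∑-swap f (x ∷ L) M = trans (cong (∑ (f x) M +_) (∑-swap f L M)) (sym (∑-+ _ _ M))

holds : {P : Set} (d : Dec P) → does d ≡ true → P
holds (yes p) _ = p

-- Boolean membership, inclusion, size test and equality of subsets.  They are the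
-- decisions used in Defs, so they agree with its countIn, φ, kSubsets and D3₂.
_∈ᵇ_ : ∀ {v} → Fin v → Subset v → Bool
x ∈ᵇ p = does (x ∈? p)

_⊆ᵇ_ : ∀ {v} → Subset v → Subset v → Bool
p ⊆ᵇ q = does (p ⊆? q)

isSize : ∀ {v} → ℕ → Subset v → Bool
isSize k S = does (∣ S ∣ ≟ℕ k)

_≟ₛ_ : ∀ {v} → DecidableEquality (Subset v)
_≟ₛ_ = VecP.≡-dec BoolP._≟_

⊆ᵇ-size : ∀ {v} {p q : Subset v} → p ⊆ᵇ q ≡ true → ∣ p ∣ ≤ ∣ q ∣
⊆ᵇ-size {p = p} {q} s = p⊆q⇒∣p∣≤∣q∣ (holds (p ⊆? q) s)

⊆ᵇ-∪ : ∀ {v} (p q t : Subset v) → (p ∪ q) ⊆ᵇ t ≡ p ⊆ᵇ t ∧ q ⊆ᵇ t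
⊆ᵇ-∪ [] [] [] = refl
⊆ᵇ-∪ (false ∷ p) (false ∷ q) (_ ∷ t) = ⊆ᵇ-∪ p q t
⊆ᵇ-∪ (true ∷ p) (false ∷ q) (true ∷ t) = ⊆ᵇ-∪ p q t
⊆ᵇ-∪ (true ∷ p) (false ∷ q) (false ∷ t) = refl
⊆ᵇ-∪ (false ∷ p) (true ∷ q) (true ∷ t) = ⊆ᵇ-∪ p q t
⊆ᵇ-∪ (false ∷ p) (true ∷ q) (false ∷ t) = sym (∧-zeroʳ (p ⊆ᵇ t))
⊆ᵇ-∪ (true ∷ p) (true ∷ q) (true ∷ t) = ⊆ᵇ-∪ p q t
⊆ᵇ-∪ (true ∷ p) (true ∷ q) (false ∷ t) = refl

⁅⁆-⊆ᵇ : ∀ {v} (x : Fin v) (t : Subset v) → ⁅ x ⁆ ⊆ᵇ t ≡ x ∈ᵇ t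
⁅⁆-⊆ᵇ zero (true ∷ t) = dec-true (⊥ ⊆? t) ⊥⊆
⁅⁆-⊆ᵇ zero (false ∷ t) = refl
⁅⁆-⊆ᵇ (suc x) (_ ∷ t) = ⁅⁆-⊆ᵇ x t

∩-full : ∀ {v} (p q : Subset v) → does (∣ p ∩ q ∣ ≟ℕ ∣ p ∣) ≡ p ⊆ᵇ q
∩-full [] [] = refl
∩-full (false ∷ p) (_ ∷ q) = ∩-full p q
∩-full (true ∷ p) (true ∷ q) = ∩-full p q
∩-full (true ∷ p) (false ∷ q) =
  dec-false (∣ p ∩ q ∣ ≟ℕ suc ∣ p ∣) (λ e → <⇒≢ (s≤s (∣p∩q∣≤∣p∣ p q)) e)

⊆ᵇ-same-size : ∀ {v} (p q : Subset v) → ∣ p ∣ ≡ ∣ q ∣ → p ⊆ᵇ q ≡ does (p ≟ₛ q)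
⊆ᵇ-same-size [] [] _ = refl
⊆ᵇ-same-size (false ∷ p) (false ∷ q) e = ⊆ᵇ-same-size p q e
⊆ᵇ-same-size (true ∷ p) (true ∷ q) e = ⊆ᵇ-same-size p q (suc-injective e)
⊆ᵇ-same-size (true ∷ p) (false ∷ q) _ = refl
⊆ᵇ-same-size (false ∷ p) (true ∷ q) e =
  dec-false (p ⊆? q) (λ p⊆q → <⇒≱ (≤-reflexive (sym e)) (p⊆q⇒∣p∣≤∣q∣ p⊆q))

∣∪∣+∣∩∣ : ∀ {v} (p q : Subset v) → ∣ p ∪ q ∣ + ∣ p ∩ q ∣ ≡ ∣ p ∣ + ∣ q ∣
∣∪∣+∣∩∣ [] [] = refl
∣∪∣+∣∩∣ (true ∷ p) (true ∷ q) =
  cong suc (trans (+-suc ∣ p ∪ q ∣ ∣ p ∩ q ∣) (trans (cong suc (∣∪∣+∣∩∣ p q)) (sym (+-suc ∣ p ∣ ∣ q ∣))))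
∣∪∣+∣∩∣ (true ∷ p) (false ∷ q) = cong suc (∣∪∣+∣∩∣ p q)
∣∪∣+∣∩∣ (false ∷ p) (true ∷ q) = trans (cong suc (∣∪∣+∣∩∣ p q)) (sym (+-suc ∣ p ∣ ∣ q ∣))
∣∪∣+∣∩∣ (false ∷ p) (false ∷ q) = ∣∪∣+∣∩∣ p q

∣⁅x⁆∪⁅y⁆∣ : ∀ {v} {x y : Fin v} → x ≢ y → ∣ ⁅ x ⁆ ∪ ⁅ y ⁆ ∣ ≡ 2
∣⁅x⁆∪⁅y⁆∣ {x = x} {y} x≢y = +-cancelʳ-≡ 0 _ 2 (begin
  ∣ ⁅ x ⁆ ∪ ⁅ y ⁆ ∣ + 0                     ≡⟨ cong (∣ ⁅ x ⁆ ∪ ⁅ y ⁆ ∣ +_) (sym (disjoint x y x≢y)) ⟩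
  ∣ ⁅ x ⁆ ∪ ⁅ y ⁆ ∣ + ∣ ⁅ x ⁆ ∩ ⁅ y ⁆ ∣    ≡⟨ ∣∪∣+∣∩∣ ⁅ x ⁆ ⁅ y ⁆ ⟩
  ∣ ⁅ x ⁆ ∣ + ∣ ⁅ y ⁆ ∣                     ≡⟨ cong₂ _+_ (∣⁅x⁆∣≡1 x) (∣⁅x⁆∣≡1 y) ⟩
  2 ∎)
  where
  open ≡-Reasoning
  disjoint : ∀ {v} (x y : Fin v) → x ≢ y → ∣ ⁅ x ⁆ ∩ ⁅ y ⁆ ∣ ≡ 0
  disjoint zero zero x≢y = ⊥-elim (x≢y refl)
  disjoint {suc v} zero (suc y) _ = trans (cong ∣_∣ (∩-zeroˡ ⁅ y ⁆)) (∣⊥∣≡0 v)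
  disjoint {suc v} (suc x) zero _ = trans (cong ∣_∣ (∩-zeroʳ ⁅ x ⁆)) (∣⊥∣≡0 v)
  disjoint (suc x) (suc y) x≢y = disjoint x y (λ e → x≢y (cong suc e))

allSubsets-complete : ∀ {v} (S : Subset v) → S ∈ allSubsets v
allSubsets-complete [] = here refl
allSubsets-complete {suc v} (true ∷ S) = ∈-++⁺ˡ (∈-map⁺ (true ∷_) (allSubsets-complete S))
allSubsets-complete {suc v} (false ∷ S) =
  ∈-++⁺ʳ (map (true ∷_) (allSubsets v)) (∈-map⁺ (false ∷_) (allSubsets-complete S))

allSubsets-unique : ∀ v → Unique (allSubsets v)
allSubsets-unique zero = [] ∷ []
allSubsets-unique (suc v) =
  Unique.++⁺ (Unique.map⁺ ∷-injectiveʳ (allSubsets-unique v)) (Unique.map⁺ ∷-injectiveʳ (allSubsets-unique v)) disjoint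
  where
  ∷-injectiveʳ : ∀ {b} {S T : Subset v} → _≡_ {A = Subset (suc v)} (b ∷ S) (b ∷ T) → S ≡ T
  ∷-injectiveʳ refl = refl
  disjoint : ∀ {S} → ¬ (S ∈ map (true ∷_) (allSubsets v) × S ∈ map (false ∷_) (allSubsets v))
  disjoint (m₁ , m₂) with ∈-map⁻ (true ∷_) m₁ | ∈-map⁻ (false ∷_) m₂
  ... | _ , _ , refl | _ , _ , ()

∑-allSubsets : ∀ {v} (g : Subset (suc v) → ℕ) →
  ∑ g (allSubsets (suc v)) ≡ ∑[ S ← allSubsets v ] g (true ∷ S) + ∑[ S ← allSubsets v ] g (false ∷ S)
∑-allSubsets {v} g = trans (∑-++ g (map (true ∷_) (allSubsets v)) (map (false ∷_) (allSubsets v)))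
  (cong₂ _+_ (∑-map g (true ∷_) (allSubsets v)) (∑-map g (false ∷_) (allSubsets v)))

supersets-none : ∀ {v} (A : Subset v) {k : ℕ} → k < ∣ A ∣ →
  count (λ T → isSize k T ∧ A ⊆ᵇ T) (allSubsets v) ≡ 0
supersets-none {v} A {k} k<A = count-none _ (allSubsets v) (λ T _ → too-small T)
  where
  too-small : ∀ T → isSize k T ∧ A ⊆ᵇ T ≡ false
  too-small T with A ⊆ᵇ T in A⊆T
  ... | false = ∧-zeroʳ (isSize k T)
  ... | true = cong (_∧ true) (dec-false (∣ T ∣ ≟ℕ k)
    (λ T≡k → <⇒≱ k<A (subst (∣ A ∣ ≤_) T≡k (⊆ᵇ-size {p = A} {q = T} A⊆T))))

supersets-exact : ∀ {v} (A : Subset v) (j k : ℕ) → ∣ A ∣ + j ≡ k →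
  count (λ T → isSize k T ∧ A ⊆ᵇ T) (allSubsets v) ≡ (v ∸ ∣ A ∣) C j
supersets-exact [] zero .0 refl = refl
supersets-exact [] (suc j) .(suc j) refl = refl
supersets-exact {suc v} (true ∷ A) j .(suc (∣ A ∣ + j)) refl =
  trans (∑-allSubsets (λ T → ⟦ isSize (suc (∣ A ∣ + j)) T ∧ (true ∷ A) ⊆ᵇ T ⟧))
    (trans (cong₂ _+_ (supersets-exact A j _ refl) (count-none _ (allSubsets v) (λ T _ → ∧-zeroʳ _)))
      (+-identityʳ _))
supersets-exact {suc v} (false ∷ A) zero zero e =
  trans (∑-allSubsets (λ T → ⟦ isSize 0 T ∧ (false ∷ A) ⊆ᵇ T ⟧))
    (cong₂ _+_ (count-none _ (allSubsets v) (λ _ _ → refl)) (supersets-exact A 0 0 e))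
supersets-exact {suc v} (false ∷ A) zero (suc k) e =
  trans (∑-allSubsets (λ T → ⟦ isSize (suc k) T ∧ (false ∷ A) ⊆ᵇ T ⟧))
    (cong₂ _+_ (supersets-none A (≤-reflexive (trans (sym e) (+-identityʳ ∣ A ∣)))) (supersets-exact A 0 (suc k) e))
supersets-exact {suc v} (false ∷ A) (suc j) .(∣ A ∣ + suc j) refl = begin
  count (λ T → isSize (∣ A ∣ + suc j) T ∧ (false ∷ A) ⊆ᵇ T) (allSubsets (suc v))
    ≡⟨ ∑-allSubsets (λ T → ⟦ isSize (∣ A ∣ + suc j) T ∧ (false ∷ A) ⊆ᵇ T ⟧) ⟩
  count (λ T → does (suc ∣ T ∣ ≟ℕ ∣ A ∣ + suc j) ∧ A ⊆ᵇ T) (allSubsets v)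
    + count (λ T → isSize (∣ A ∣ + suc j) T ∧ A ⊆ᵇ T) (allSubsets v)
    ≡⟨ cong₂ _+_ (trans (∑-cong (allSubsets v) shift) (supersets-exact A j _ refl)) (supersets-exact A (suc j) _ refl) ⟩
  (v ∸ ∣ A ∣) C j + (v ∸ ∣ A ∣) C suc j
    ≡⟨ nCk+nC[k+1]≡[n+1]C[k+1] (v ∸ ∣ A ∣) j ⟩
  suc (v ∸ ∣ A ∣) C suc j
    ≡⟨ cong (_C suc j) (sym (+-∸-assoc 1 (∣p∣≤n A))) ⟩
  (suc v ∸ ∣ A ∣) C suc j ∎
  where
  open ≡-Reasoning
  shift : ∀ T → ⟦ does (suc ∣ T ∣ ≟ℕ ∣ A ∣ + suc j) ∧ A ⊆ᵇ T ⟧ ≡ ⟦ isSize (∣ A ∣ + j) T ∧ A ⊆ᵇ T ⟧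
  shift T = cong (λ n → ⟦ does (suc ∣ T ∣ ≟ℕ n) ∧ A ⊆ᵇ T ⟧) (+-suc ∣ A ∣ j)

supersetCount : ℕ → ℕ → ℕ → ℕ
supersetCount v k m with m ≤? k
... | yes _ = (v ∸ m) C (k ∸ m)
... | no _ = 0

supersets : ∀ {v} (k : ℕ) (A : Subset v) →
  count (λ T → isSize k T ∧ A ⊆ᵇ T) (allSubsets v) ≡ supersetCount v k ∣ A ∣
supersets k A with ∣ A ∣ ≤? k
... | yes A≤k = supersets-exact A (k ∸ ∣ A ∣) k (m+[n∸m]≡n A≤k)
... | no A≰k = supersets-none A (≰⇒> A≰k)

-- The first two moments of a block design

Replicated : ∀ {v} → ℕ → List (Subset v) → Set
Replicated r E = ∀ x → count (x ∈ᵇ_) E ≡ r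

Balanced : ∀ {v} → ℕ → List (Subset v) → Set
Balanced lam E = ∀ x y → x ≢ y → count (λ B → x ∈ᵇ B ∧ y ∈ᵇ B) E ≡ lam

module _ {v b r k lam} {E : List (Subset v)} (isd : IsBlockDesign v b r k lam E) where
  open IsBlockDesign isd

  design-replicated : Replicated r E
  design-replicated x = trans (sym (length-filter (x ∈?_) E)) (replicated x)

  design-balanced : Balanced lam E
  design-balanced x y x≢y = begin
    count (λ B → x ∈ᵇ B ∧ y ∈ᵇ B) E         ≡⟨ sym (count-filter (x ∈?_) (y ∈ᵇ_) E) ⟩
    count (y ∈ᵇ_) (filter (x ∈?_) E)        ≡⟨ sym (length-filter (y ∈?_) (filter (x ∈?_) E)) ⟩
    countIn₂ y x E                          ≡⟨ balanced y x (≢-sym x≢y) ⟩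
    lam ∎
    where open ≡-Reasoning

restrict : ∀ {v} → List (Subset (suc v)) → List (Subset v)
restrict = map tail

derived : ∀ {v} → List (Subset (suc v)) → List (Subset v)
derived E = map tail (filterᵇ head E)

head≡∈ᵇ : ∀ {v} (B : Subset (suc v)) → head B ≡ zero ∈ᵇ B
head≡∈ᵇ (true ∷ B) = refl
head≡∈ᵇ (false ∷ B) = refl

module _ {v} (E : List (Subset (suc v))) where

  restrict-replicated : ∀ {r} → Replicated r E → Replicated r (restrict E)
  restrict-replicated rep x = trans (∑-map _ tail E) (trans (∑-cong E (λ { (_ ∷ B) → refl })) (rep (suc x)))

  restrict-balanced : ∀ {lam} → Balanced lam E → Balanced lam (restrict E)
  restrict-balanced bal x y x≢y = trans (∑-map _ tail E) (trans (∑-cong E (λ { (_ ∷ B) → refl }))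
    (bal (suc x) (suc y) (λ e → x≢y (FinP.suc-injective e))))

  derived-replicated : ∀ {lam} → Balanced lam E → Replicated lam (derived E)
  derived-replicated bal x = begin
    count (x ∈ᵇ_) (derived E)                     ≡⟨ ∑-map _ tail (filterᵇ head E) ⟩
    count (λ B → x ∈ᵇ tail B) (filterᵇ head E)    ≡⟨ count-filter (λ B → T? (head B)) _ E ⟩
    count (λ B → head B ∧ x ∈ᵇ tail B) E          ≡⟨ ∑-cong E (λ { (b ∷ B) → cong (λ c → ⟦ c ∧ x ∈ᵇ B ⟧) (head≡∈ᵇ (b ∷ B)) }) ⟩
    count (λ B → zero ∈ᵇ B ∧ suc x ∈ᵇ B) E        ≡⟨ bal zero (suc x) (λ ()) ⟩
    _ ∎
    where open ≡-Reasoning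

first-moment : ∀ {v r} (E : List (Subset v)) → Replicated r E → (M : Subset v) →
  ∑[ B ← E ] ∣ M ∩ B ∣ ≡ r * ∣ M ∣
first-moment {r = r} E rep [] = trans (∑-cong E (λ { [] → refl })) (trans (∑-zero E) (sym (*-zeroʳ r)))
first-moment E rep (false ∷ M) = trans (∑-cong E (λ { (_ ∷ B) → refl }))
  (trans (sym (∑-map _ tail E)) (first-moment (restrict E) (restrict-replicated E rep) M))
first-moment {r = r} E rep (true ∷ M) = begin
  ∑[ B ← E ] ∣ (true ∷ M) ∩ B ∣                   ≡⟨ ∑-cong E split ⟩
  ∑[ B ← E ] (⟦ zero ∈ᵇ B ⟧ + ∣ M ∩ tail B ∣)     ≡⟨ ∑-+ _ _ E ⟩
  count (zero ∈ᵇ_) E + ∑[ B ← E ] ∣ M ∩ tail B ∣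
    ≡⟨ cong₂ _+_ (rep zero) (trans (sym (∑-map _ tail E)) (first-moment (restrict E) (restrict-replicated E rep) M)) ⟩
  r + r * ∣ M ∣                                   ≡⟨ sym (*-suc r ∣ M ∣) ⟩
  r * suc ∣ M ∣ ∎
  where
  open ≡-Reasoning
  split : ∀ B → ∣ (true ∷ M) ∩ B ∣ ≡ ⟦ zero ∈ᵇ B ⟧ + ∣ M ∩ tail B ∣
  split (true ∷ B) = refl
  split (false ∷ B) = refl

pairs-suc : ∀ m → suc m C 2 ≡ m + m C 2
pairs-suc m = trans (sym (nCk+nC[k+1]≡[n+1]C[k+1] m 1)) (cong (_+ m C 2) (nC1≡n m))

second-moment : ∀ {v lam} (E : List (Subset v)) → Balanced lam E → (M : Subset v) →
  ∑[ B ← E ] (∣ M ∩ B ∣ C 2) ≡ lam * (∣ M ∣ C 2)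
second-moment {lam = lam} E bal [] = trans (∑-cong E (λ { [] → refl })) (trans (∑-zero E) (sym (*-zeroʳ lam)))
second-moment E bal (false ∷ M) = trans (∑-cong E (λ { (_ ∷ B) → refl }))
  (trans (sym (∑-map _ tail E)) (second-moment (restrict E) (restrict-balanced E bal) M))
second-moment {lam = lam} E bal (true ∷ M) = begin
  ∑[ B ← E ] (∣ (true ∷ M) ∩ B ∣ C 2)
    ≡⟨ ∑-cong E split ⟩
  ∑[ B ← E ] (⟦ head B ⟧ * ∣ M ∩ tail B ∣ + ∣ M ∩ tail B ∣ C 2)
    ≡⟨ ∑-+ _ _ E ⟩
  ∑[ B ← E ] (⟦ head B ⟧ * ∣ M ∩ tail B ∣) + ∑[ B ← E ] (∣ M ∩ tail B ∣ C 2)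
    ≡⟨ cong₂ _+_ through-first-point restricted ⟩
  lam * ∣ M ∣ + lam * (∣ M ∣ C 2)
    ≡⟨ sym (*-distribˡ-+ lam ∣ M ∣ (∣ M ∣ C 2)) ⟩
  lam * (∣ M ∣ + ∣ M ∣ C 2)
    ≡⟨ cong (lam *_) (sym (pairs-suc ∣ M ∣)) ⟩
  lam * (suc ∣ M ∣ C 2) ∎
  where
  open ≡-Reasoning
  split : ∀ B → ∣ (true ∷ M) ∩ B ∣ C 2 ≡ ⟦ head B ⟧ * ∣ M ∩ tail B ∣ + ∣ M ∩ tail B ∣ C 2
  split (true ∷ B) = trans (pairs-suc ∣ M ∩ B ∣) (cong (_+ ∣ M ∩ B ∣ C 2) (sym (*-identityˡ ∣ M ∩ B ∣)))
  split (false ∷ B) = refl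
  through-first-point : ∑[ B ← E ] (⟦ head B ⟧ * ∣ M ∩ tail B ∣) ≡ lam * ∣ M ∣
  through-first-point = trans (sym (trans (∑-map _ tail (filterᵇ head E)) (∑-filter (λ B → T? (head B)) _ E)))
    (first-moment (derived E) (derived-replicated E bal) M)
  restricted : ∑[ B ← E ] (∣ M ∩ tail B ∣ C 2) ≡ lam * (∣ M ∣ C 2)
  restricted = trans (sym (∑-map _ tail E)) (second-moment (restrict E) (restrict-balanced E bal) M)

-- Intersection profiles

levels : {A : Set} → (A → ℕ) → List A → ℕ → ℕ
levels g L j = count (λ x → does (g x ≟ℕ j)) L

weigh : (ℕ → ℕ) → (ℕ → ℕ) → ℕ
weigh h z = h 0 * z 0 + (h 1 * z 1 + (h 2 * z 2 + h 3 * z 3))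

weigh-cong : (h : ℕ → ℕ) {z w : ℕ → ℕ} → (∀ j → z j ≡ w j) → weigh h z ≡ weigh h w
weigh-cong h e = cong₂ _+_ (cong (h 0 *_) (e 0)) (cong₂ _+_ (cong (h 1 *_) (e 1))
  (cong₂ _+_ (cong (h 2 *_) (e 2)) (cong (h 3 *_) (e 3))))

∑-by-levels : {A : Set} (g : A → ℕ) (h : ℕ → ℕ) (L : List A) → All (λ x → g x ≤ 3) L →
  ∑[ x ← L ] h (g x) ≡ weigh h (levels g L)
∑-by-levels g h [] [] = sym (vanish (h 0) (h 1) (h 2) (h 3))
  where
  vanish : ∀ a b c d → a * 0 + (b * 0 + (c * 0 + d * 0)) ≡ 0
  vanish = solve-∀
∑-by-levels g h (x ∷ L) (gx≤3 ∷ bounded) = begin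
  h (g x) + ∑[ y ← L ] h (g y)
    ≡⟨ cong₂ _+_ (sym (weigh-indicator (g x) gx≤3)) (∑-by-levels g h L bounded) ⟩
  weigh h (λ j → ⟦ does (g x ≟ℕ j) ⟧) + weigh h (levels g L)
    ≡⟨ sym (weigh-+ (λ j → ⟦ does (g x ≟ℕ j) ⟧) (levels g L)) ⟩
  weigh h (levels g (x ∷ L)) ∎
  where
  open ≡-Reasoning
  weigh-+ : (z w : ℕ → ℕ) → weigh h (λ j → z j + w j) ≡ weigh h z + weigh h w
  weigh-+ z w = distrib (h 0) (h 1) (h 2) (h 3) (z 0) (z 1) (z 2) (z 3) (w 0) (w 1) (w 2) (w 3)
    where
    distrib : ∀ a b c d z₀ z₁ z₂ z₃ w₀ w₁ w₂ w₃ →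
      a * (z₀ + w₀) + (b * (z₁ + w₁) + (c * (z₂ + w₂) + d * (z₃ + w₃)))
        ≡ (a * z₀ + (b * z₁ + (c * z₂ + d * z₃))) + (a * w₀ + (b * w₁ + (c * w₂ + d * w₃)))
    distrib = solve-∀
  weigh-indicator : ∀ n → n ≤ 3 → weigh h (λ j → ⟦ does (n ≟ℕ j) ⟧) ≡ h n
  weigh-indicator 0 _ = pick₀ (h 0) (h 1) (h 2) (h 3)
    where
    pick₀ : ∀ a b c d → a * 1 + (b * 0 + (c * 0 + d * 0)) ≡ a
    pick₀ = solve-∀
  weigh-indicator 1 _ = pick₁ (h 0) (h 1) (h 2) (h 3)
    where
    pick₁ : ∀ a b c d → a * 0 + (b * 1 + (c * 0 + d * 0)) ≡ b
    pick₁ = solve-∀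
  weigh-indicator 2 _ = pick₂ (h 0) (h 1) (h 2) (h 3)
    where
    pick₂ : ∀ a b c d → a * 0 + (b * 0 + (c * 1 + d * 0)) ≡ c
    pick₂ = solve-∀
  weigh-indicator 3 _ = pick₃ (h 0) (h 1) (h 2) (h 3)
    where
    pick₃ : ∀ a b c d → a * 0 + (b * 0 + (c * 0 + d * 1)) ≡ d
    pick₃ = solve-∀
  weigh-indicator (suc (suc (suc (suc _)))) (s≤s (s≤s (s≤s ())))

levels-vanish : {A : Set} {g : A → ℕ} {L : List A} {m j : ℕ} → All (λ x → g x ≤ m) L → m < j → levels g L j ≡ 0
levels-vanish {g = g} {L} {j = j} bounded m<j = count-none _ L (λ x x∈L →
  dec-false (g x ≟ℕ j) (λ gx≡j → <⇒≱ m<j (subst (_≤ _) gx≡j (All.lookup bounded x∈L))))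

-- The levels 0, …, 3 are determined by the top level and the three moments
-- ∑ 1, ∑ j and ∑ (j choose 2), since this linear system is triangular.
levels-solve : (z w : ℕ → ℕ) →
  weigh (λ _ → 1) z ≡ weigh (λ _ → 1) w → weigh (λ j → j) z ≡ weigh (λ j → j) w →
  weigh (_C 2) z ≡ weigh (_C 2) w → z 3 ≡ w 3 → ∀ j → j ≤ 3 → z j ≡ w j
levels-solve z w m₀ m₁ m₂ e₃ = solution
  where
  e₂ : z 2 ≡ w 2
  e₂ = *-cancelˡ-≡ (z 2) (w 2) 1 (+-cancelʳ-≡ (3 * z 3) (1 * z 2) (1 * w 2)
    (trans m₂ (cong (λ t → 1 * w 2 + 3 * t) (sym e₃))))
  e₁ : z 1 ≡ w 1
  e₁ = *-cancelˡ-≡ (z 1) (w 1) 1 (+-cancelʳ-≡ (2 * z 2 + 3 * z 3) (1 * z 1) (1 * w 1)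
    (trans m₁ (cong₂ (λ s t → 1 * w 1 + (2 * s + 3 * t)) (sym e₂) (sym e₃))))
  e₀ : z 0 ≡ w 0
  e₀ = *-cancelˡ-≡ (z 0) (w 0) 1 (+-cancelʳ-≡ (1 * z 1 + (1 * z 2 + 1 * z 3)) (1 * z 0) (1 * w 0)
    (trans m₀ (cong (1 * w 0 +_) (sym (cong₂ (λ s t → 1 * s + t) e₁ (cong₂ (λ s t → 1 * s + 1 * t) e₂ e₃))))))
  solution : ∀ j → j ≤ 3 → z j ≡ w j
  solution 0 _ = e₀
  solution 1 _ = e₁
  solution 2 _ = e₂
  solution 3 _ = e₃
  solution (suc (suc (suc (suc _)))) (s≤s (s≤s (s≤s ())))

profile : ∀ {v} → List (Subset v) → Subset v → ℕ → ℕ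
profile E M = levels (λ B → ∣ M ∩ B ∣) E

φ-profile : ∀ {v} (k : ℕ) (E : List (Subset v)) (M : Subset v) →
  φ k E M ≡ tabulate (λ j → profile E M (toℕ j))
φ-profile k E M = VecP.tabulate-cong (λ j → length-filter (λ B → ∣ M ∩ B ∣ ≟ℕ toℕ j) E)

Meets≤3 : ∀ {v} → List (Subset v) → Subset v → Set
Meets≤3 E M = All (λ B → ∣ M ∩ B ∣ ≤ 3) E

meets-small-set : ∀ {v} (E : List (Subset v)) (M : Subset v) → ∣ M ∣ ≤ 3 → Meets≤3 E M
meets-small-set E M M≤3 = All.tabulate (λ {B} _ → ≤-trans (∣p∩q∣≤∣p∣ M B) M≤3)

meets-triples : ∀ {v} {E : List (Subset v)} (M : Subset v) → All (λ B → ∣ B ∣ ≡ 3) E → Meets≤3 E M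
meets-triples M sizes = All.map (λ {B} B≡3 → subst (∣ M ∩ B ∣ ≤_) B≡3 (∣p∩q∣≤∣q∣ M B)) sizes

module _ {v b r k lam} {E : List (Subset v)} (isd : IsBlockDesign v b r k lam E) where

  profile-determined : (M M′ : Subset v) → Meets≤3 E M → Meets≤3 E M′ → ∣ M ∣ ≡ ∣ M′ ∣ →
    profile E M 3 ≡ profile E M′ 3 → ∀ j → profile E M j ≡ profile E M′ j
  profile-determined M M′ meets meets′ M≡M′ e₃ j with j ≤? 3
  ... | yes j≤3 = levels-solve (profile E M) (profile E M′)
    (same-moment (λ _ → 1) (λ _ → ∑[ B ← E ] 1) (λ _ → refl))
    (same-moment (λ j → j) (r *_) (first-moment E (design-replicated isd)))
    (same-moment (_C 2) (λ m → lam * (m C 2)) (second-moment E (design-balanced isd)))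
    e₃ j j≤3
    where
    open ≡-Reasoning
    same-moment : (h F : ℕ → ℕ) → (∀ N → ∑[ B ← E ] h ∣ N ∩ B ∣ ≡ F ∣ N ∣) →
      weigh h (profile E M) ≡ weigh h (profile E M′)
    same-moment h F moment = begin
      weigh h (profile E M)     ≡⟨ sym (∑-by-levels _ h E meets) ⟩
      ∑[ B ← E ] h ∣ M ∩ B ∣    ≡⟨ moment M ⟩
      F ∣ M ∣                   ≡⟨ cong F M≡M′ ⟩
      F ∣ M′ ∣                  ≡⟨ sym (moment M′) ⟩
      ∑[ B ← E ] h ∣ M′ ∩ B ∣   ≡⟨ ∑-by-levels _ h E meets′ ⟩
      weigh h (profile E M′) ∎
  ... | no j≰3 = trans (levels-vanish meets (≰⇒> j≰3)) (sym (levels-vanish meets′ (≰⇒> j≰3)))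

  φ-determined : (n : ℕ) (M M′ : Subset v) → Meets≤3 E M → Meets≤3 E M′ → ∣ M ∣ ≡ ∣ M′ ∣ →
    profile E M 3 ≡ profile E M′ 3 → φ n E M ≡ φ n E M′
  φ-determined n M M′ meets meets′ M≡M′ e₃ =
    trans (φ-profile n E M) (trans (VecP.tabulate-cong (λ j → profile-determined M M′ meets meets′ M≡M′ e₃ (toℕ j)))
      (sym (φ-profile n E M′)))

φ-constant : ∀ {v k n m c} {E X : List (Subset v)} → IsDesign v k E →
  (∀ {A} → A ∈ X → ∣ A ∣ ≡ m) → (∀ {A} → A ∈ X → Meets≤3 E A) → (∀ {A} → A ∈ X → profile E A 3 ≡ c) →
  ∀ A A′ → A ∈ X → A′ ∈ X → φ n E A ≡ φ n E A′
φ-constant {n = n} (_ , _ , _ , isd) size meets top A A′ A∈X A′∈X =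
  φ-determined isd n A A′ (meets A∈X) (meets A′∈X) (trans (size A∈X) (sym (size A′∈X))) (trans (top A∈X) (sym (top A′∈X)))

-- Blocks through a set, and regular families

through : ∀ {v} → List (Subset v) → Subset v → ℕ
through E P = count (P ⊆ᵇ_) E

meets-whole : ∀ {v n} (S B : Subset v) → ∣ B ∣ ≡ n → does (∣ S ∩ B ∣ ≟ℕ n) ≡ B ⊆ᵇ S
meets-whole S B B≡n = trans (cong₂ (λ X n → does (∣ X ∣ ≟ℕ n)) (∩-comm S B) (sym B≡n)) (∩-full B S)

through-profile : ∀ {v} (E : List (Subset v)) (P : Subset v) → through E P ≡ profile E P ∣ P ∣
through-profile E P = ∑-cong E (λ B → cong ⟦_⟧ (sym (∩-full P B)))

through-point : ∀ {v} (x : Fin v) (E : List (Subset v)) → countIn x E ≡ through E ⁅ x ⁆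
through-point x E = trans (length-filter (x ∈?_) E) (∑-cong E (λ B → cong ⟦_⟧ (sym (⁅⁆-⊆ᵇ x B))))

through-pair : ∀ {v} (x y : Fin v) (E : List (Subset v)) → countIn₂ x y E ≡ through E (⁅ y ⁆ ∪ ⁅ x ⁆)
through-pair x y E = begin
  countIn₂ x y E                      ≡⟨ length-filter (x ∈?_) (filter (y ∈?_) E) ⟩
  count (x ∈ᵇ_) (filter (y ∈?_) E)    ≡⟨ count-filter (y ∈?_) (x ∈ᵇ_) E ⟩
  count (λ B → y ∈ᵇ B ∧ x ∈ᵇ B) E     ≡⟨ ∑-cong E (λ B → cong ⟦_⟧ (sym (pair B))) ⟩
  through E (⁅ y ⁆ ∪ ⁅ x ⁆) ∎
  where
  open ≡-Reasoning
  pair : ∀ B → (⁅ y ⁆ ∪ ⁅ x ⁆) ⊆ᵇ B ≡ y ∈ᵇ B ∧ x ∈ᵇ B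
  pair B = trans (⊆ᵇ-∪ ⁅ y ⁆ ⁅ x ⁆ B) (cong₂ _∧_ (⁅⁆-⊆ᵇ y B) (⁅⁆-⊆ᵇ x B))

Regular : ∀ {v} → List (Subset v) → Set
Regular {v} E = ∀ (P Q : Subset v) → ∣ P ∣ ≡ ∣ Q ∣ → ∣ P ∣ ≤ 2 → through E P ≡ through E Q

module _ {v b r k lam} {E : List (Subset v)} (isd : IsBlockDesign v b r k lam E) where

  -- Sets of at most two points meet no block in three points, so by profile-determined
  -- their profile depends only on their size.
  small-profiles : {P Q : Subset v} → ∣ P ∣ ≡ ∣ Q ∣ → ∣ P ∣ ≤ 2 → ∀ j → profile E P j ≡ profile E Q j
  small-profiles {P} {Q} P≡Q P≤2 = profile-determined isd P Q
    (meets-small-set E P (≤-trans P≤2 (n≤1+n 2))) (meets-small-set E Q (≤-trans Q≤2 (n≤1+n 2)))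
    P≡Q (trans (top-empty P P≤2) (sym (top-empty Q Q≤2)))
    where
    Q≤2 : ∣ Q ∣ ≤ 2
    Q≤2 = subst (_≤ 2) P≡Q P≤2
    top-empty : ∀ S → ∣ S ∣ ≤ 2 → profile E S 3 ≡ 0
    top-empty S S≤2 = levels-vanish (All.tabulate {xs = E} (λ {B} _ → ∣p∩q∣≤∣p∣ S B)) (s≤s S≤2)

  design-regular : Regular E
  design-regular P Q P≡Q P≤2 = begin
    through E P          ≡⟨ through-profile E P ⟩
    profile E P ∣ P ∣    ≡⟨ small-profiles {P} {Q} P≡Q P≤2 ∣ P ∣ ⟩
    profile E Q ∣ P ∣    ≡⟨ cong (profile E Q) P≡Q ⟩
    profile E Q ∣ Q ∣    ≡⟨ sym (through-profile E Q) ⟩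
    through E Q ∎
    where open ≡-Reasoning

pointDegree : ∀ {v} → List (Subset v) → ℕ
pointDegree {zero} E = 0
pointDegree {suc v} E = through E ⁅ zero ⁆

pairDegree : ∀ {v} → List (Subset v) → ℕ
pairDegree {zero} E = 0
pairDegree {suc zero} E = 0
pairDegree {suc (suc v)} E = through E (⁅ suc zero ⁆ ∪ ⁅ zero ⁆)

regular-replicated : ∀ {v} {E : List (Subset v)} → Regular E → ∀ x → countIn x E ≡ pointDegree E
regular-replicated {suc v} {E} regular x = trans (through-point x E)
  (regular ⁅ x ⁆ ⁅ zero ⁆ (trans (∣⁅x⁆∣≡1 x) (sym (∣⁅x⁆∣≡1 {suc v} zero)))
    (subst (_≤ 2) (sym (∣⁅x⁆∣≡1 x)) (s≤s z≤n)))

regular-balanced : ∀ {v} {E : List (Subset v)} → Regular E → ∀ x y → x ≢ y → countIn₂ x y E ≡ pairDegree E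
regular-balanced {suc zero} regular zero zero x≢y = ⊥-elim (x≢y refl)
regular-balanced {suc (suc v)} {E} regular x y x≢y = trans (through-pair x y E)
  (regular (⁅ y ⁆ ∪ ⁅ x ⁆) (⁅ suc zero ⁆ ∪ ⁅ zero ⁆)
    (trans two (sym (∣⁅x⁆∪⁅y⁆∣ {suc (suc v)} {suc zero} {zero} (λ ())))) (≤-reflexive two))
  where
  two : ∣ ⁅ y ⁆ ∪ ⁅ x ⁆ ∣ ≡ 2
  two = ∣⁅x⁆∪⁅y⁆∣ (≢-sym x≢y)

regular-design : ∀ {v k} {E : List (Subset v)} → Unique E → All (λ B → ∣ B ∣ ≡ k) E → Regular E → IsDesign v k E
regular-design {E = E} unique sizes regular = length E , pointDegree E , pairDegree E , record
  { numBlocks = refl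
  ; blockSize = sizes
  ; simple = unique
  ; replicated = regular-replicated regular
  ; balanced = regular-balanced regular
  }

-- If E and E′ together are the k-subsets of Fin v (as far as counting is concerned),
-- the number of blocks of E′ through P is the number of k-sets through P minus that of E;
-- so E′ is regular along with E.
complement-regular : ∀ {v k} (E E′ : List (Subset v)) →
  (∀ f → count f E′ + count f E ≡ count (λ T → isSize k T ∧ f T) (allSubsets v)) → Regular E → Regular E′
complement-regular {v} {k} E E′ partition regular P Q P≡Q P≤2 = begin
  through E′ P                             ≡⟨ complement P ⟩
  supersetCount v k ∣ P ∣ ∸ through E P    ≡⟨ cong₂ (λ m t → supersetCount v k m ∸ t) P≡Q (regular P Q P≡Q P≤2) ⟩
  supersetCount v k ∣ Q ∣ ∸ through E Q    ≡⟨ sym (complement Q) ⟩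
  through E′ Q ∎
  where
  open ≡-Reasoning
  complement : ∀ P → through E′ P ≡ supersetCount v k ∣ P ∣ ∸ through E P
  complement P = trans (sym (m+n∸n≡m (through E′ P) (through E P)))
    (cong (_∸ through E P) (trans (partition (P ⊆ᵇ_)) (supersets k P)))

module _ {A : Set} (_≟_ : DecidableEquality A) where
  open DecMembership _≟_ using () renaming (_∈?_ to _∈?ₗ_)

  occurrences-∉ : (S : A) (L : List A) → S ∉ L → count (λ B → does (B ≟ S)) L ≡ 0
  occurrences-∉ S L S∉L = count-none _ L (λ B B∈L → dec-false (B ≟ S) (λ { refl → S∉L B∈L }))

  occurrences-∈ : {S : A} {L : List A} → Unique L → S ∈ L → count (λ B → does (B ≟ S)) L ≡ 1
  occurrences-∈ {S} {_ ∷ L} (S∉L ∷ _) (here refl) = cong₂ _+_ (cong ⟦_⟧ (dec-true (S ≟ S) refl))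
    (occurrences-∉ S L (λ S∈L → All.lookup S∉L S∈L refl))
  occurrences-∈ {S} {B ∷ L} (B∉L ∷ unique) (there S∈L) =
    cong₂ _+_ (cong ⟦_⟧ (dec-false (B ≟ S) (All.lookup B∉L S∈L))) (occurrences-∈ unique S∈L)

  count-members : {U : List A} → Unique U → (∀ S → S ∈ U) → (f : A → Bool) (D : List A) → Unique D →
    count (λ S → does (S ∈?ₗ D) ∧ f S) U ≡ count f D
  count-members {U} _ _ f [] _ = count-none _ U (λ _ _ → refl)
  count-members {U} unique complete f (d ∷ D) (d∉D ∷ uniqueD) = begin
    count (λ S → (does (S ≟ d) ∨ does (S ∈?ₗ D)) ∧ f S) U
      ≡⟨ ∑-cong U split ⟩
    ∑[ S ← U ] (⟦ does (S ≟ d) ∧ f S ⟧ + ⟦ does (S ∈?ₗ D) ∧ f S ⟧)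
      ≡⟨ ∑-+ _ _ U ⟩
    count (λ S → does (S ≟ d) ∧ f S) U + count (λ S → does (S ∈?ₗ D) ∧ f S) U
      ≡⟨ cong₂ _+_ (trans (∑-cong U at-d) (single (f d))) (count-members unique complete f D uniqueD) ⟩
    ⟦ f d ⟧ + count f D ∎
    where
    open ≡-Reasoning
    split : ∀ S → ⟦ (does (S ≟ d) ∨ does (S ∈?ₗ D)) ∧ f S ⟧
                    ≡ ⟦ does (S ≟ d) ∧ f S ⟧ + ⟦ does (S ∈?ₗ D) ∧ f S ⟧
    split S with S ≟ d
    ... | no _ = refl
    ... | yes refl rewrite dec-false (S ∈?ₗ D) (λ S∈D → All.lookup d∉D S∈D refl) = sym (+-identityʳ _)
    at-d : ∀ S → ⟦ does (S ≟ d) ∧ f S ⟧ ≡ ⟦ does (S ≟ d) ∧ f d ⟧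
    at-d S with S ≟ d
    ... | no _ = refl
    ... | yes refl = refl
    single : ∀ b → count (λ S → does (S ≟ d) ∧ b) U ≡ ⟦ b ⟧
    single true = trans (∑-cong U (λ S → cong ⟦_⟧ (BoolP.∧-identityʳ (does (S ≟ d))))) (occurrences-∈ unique (complete d))
    single false = trans (∑-cong U (λ S → cong ⟦_⟧ (∧-zeroʳ (does (S ≟ d))))) (∑-zero U)

count-at-most-one : {A : Set} {ℓ : Level} {P : Pred A ℓ} (P? : Decidable P) (D : List A) → Unique D →
  (∀ {x y} → x ∈ D → y ∈ D → P x → P y → x ≡ y) → count (λ x → does (P? x)) D ≡ ⟦ does (any? P? D) ⟧
count-at-most-one P? [] _ _ = refl
count-at-most-one P? (d ∷ D) (d∉D ∷ unique) one with P? d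
... | yes Pd = cong suc (count-none _ D (λ x x∈D →
  dec-false (P? x) (λ Px → All.lookup d∉D x∈D (one (here refl) (there x∈D) Pd Px))))
... | no _ = count-at-most-one P? D unique (λ x∈D y∈D → one (there x∈D) (there y∈D))

count-any : {T Bl : Set} {ℓ : Level} {R : Bl → T → Set ℓ} (p : T → Bool) (R? : ∀ B t → Dec (R B t))
  (D : List Bl) (L : List T) → Unique D →
  (∀ t → p t ≡ true → ∀ {B₁ B₂} → B₁ ∈ D → B₂ ∈ D → R B₁ t → R B₂ t → B₁ ≡ B₂) →
  count (λ t → p t ∧ does (any? (λ B → R? B t) D)) L ≡ ∑[ B ← D ] count (λ t → p t ∧ does (R? B t)) L
count-any p R? D L unique one = trans (∑-cong L pointwise) (∑-swap (λ t B → ⟦ p t ∧ does (R? B t) ⟧) L D)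
  where
  pointwise : ∀ t → ⟦ p t ∧ does (any? (λ B → R? B t) D) ⟧ ≡ ∑[ B ← D ] ⟦ p t ∧ does (R? B t) ⟧
  pointwise t with p t in pt
  ... | false = sym (∑-zero D)
  ... | true = sym (count-at-most-one (λ B → R? B t) D unique (one t pt))

module Class {v : ℕ} (k : ℕ) {ℓ : Level} {P : Pred (Subset v) ℓ} (P? : Decidable P) where

  members⁺ : ∀ {S} → ∣ S ∣ ≡ k → P S → S ∈ filter P? (kSubsets v k)
  members⁺ {S} S≡k PS = ∈-filter⁺ P? (∈-filter⁺ (λ S → ∣ S ∣ ≟ℕ k) (allSubsets-complete S) S≡k) PS

  members⁻ : ∀ {S} → S ∈ filter P? (kSubsets v k) → ∣ S ∣ ≡ k × P S
  members⁻ S∈ with ∈-filter⁻ P? {xs = kSubsets v k} S∈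
  ... | S∈K , PS = proj₂ (∈-filter⁻ (λ S → ∣ S ∣ ≟ℕ k) {xs = allSubsets v} S∈K) , PS

  sizes : All (λ S → ∣ S ∣ ≡ k) (filter P? (kSubsets v k))
  sizes = All.tabulate (λ S∈ → proj₁ (members⁻ S∈))

  unique : Unique (filter P? (kSubsets v k))
  unique = Unique.filter⁺ P? (Unique.filter⁺ (λ S → ∣ S ∣ ≟ℕ k) (allSubsets-unique v))

  count-class : (f : Subset v → Bool) →
    count f (filter P? (kSubsets v k)) ≡ count (λ S → isSize k S ∧ (does (P? S) ∧ f S)) (allSubsets v)
  count-class f = trans (count-filter P? f (kSubsets v k)) (count-filter (λ S → ∣ S ∣ ≟ℕ k) _ (allSubsets v))

  partition : (f : Subset v → Bool) →
    count f (filter (λ S → ¬? (P? S)) (kSubsets v k)) + count f (filter P? (kSubsets v k))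
      ≡ count (λ S → isSize k S ∧ f S) (allSubsets v)
  partition f = trans (count-split P? f (kSubsets v k)) (count-filter (λ S → ∣ S ∣ ≟ℕ k) f (allSubsets v))

triple-profile : ∀ {v} {E : List (Subset v)} {S : Subset v} → All (λ B → ∣ B ∣ ≡ 3) E → ∣ S ∣ ≡ 3 →
  profile E S 3 ≡ count (λ B → does (B ≟ₛ S)) E
triple-profile {S = S} sizes S≡3 = ∑-congᴬ (All.map (λ {B} B≡3 → cong ⟦_⟧
  (trans (meets-whole S B B≡3) (⊆ᵇ-same-size B S (trans B≡3 (sym S≡3))))) sizes)

two-fibres : ∀ {v b r lam n} {D X₁ X₂ : List (Subset v)} → IsBlockDesign v b r 3 lam D →
  (∀ S → ∣ S ∣ ≡ n → (S ∈ X₁ × profile D S 3 ≡ 1) ⊎ (S ∈ X₂ × profile D S 3 ≡ 0)) →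
  (∀ {S} → S ∈ X₁ → profile D S 3 ≡ 1) → (∀ {S} → S ∈ X₂ → profile D S 3 ≡ 0) →
  ∀ S T → ∣ S ∣ ≡ n → ∣ T ∣ ≡ n →
    (φ 3 D S ≡ φ 3 D T ⇔ ((S ∈ X₁ × T ∈ X₁) ⊎ (S ∈ X₂ × T ∈ X₂)))
two-fibres {D = D} {X₁} {X₂} isd classify on-X₁ on-X₂ S T S≡n T≡n = mk⇔ to from
  where
  open IsBlockDesign isd
  1≢0 : 1 ≢ 0
  1≢0 ()
  same-top : φ 3 D S ≡ φ 3 D T → profile D S 3 ≡ profile D T 3
  same-top e = cong (λ w → lookup w (fromℕ 3)) (trans (sym (φ-profile 3 D S)) (trans e (φ-profile 3 D T)))
  to : φ 3 D S ≡ φ 3 D T → (S ∈ X₁ × T ∈ X₁) ⊎ (S ∈ X₂ × T ∈ X₂)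
  to e with classify S S≡n | classify T T≡n
  ... | inj₁ (S∈ , _) | inj₁ (T∈ , _) = inj₁ (S∈ , T∈)
  ... | inj₂ (S∈ , _) | inj₂ (T∈ , _) = inj₂ (S∈ , T∈)
  ... | inj₁ (_ , zS) | inj₂ (_ , zT) = ⊥-elim (1≢0 (trans (sym zS) (trans (same-top e) zT)))
  ... | inj₂ (_ , zS) | inj₁ (_ , zT) = ⊥-elim (1≢0 (trans (sym zT) (trans (sym (same-top e)) zS)))
  same-class : profile D S 3 ≡ profile D T 3 → φ 3 D S ≡ φ 3 D T
  same-class = φ-determined isd 3 S T (meets-triples S blockSize) (meets-triples T blockSize) (trans S≡n (sym T≡n))
  from : (S ∈ X₁ × T ∈ X₁) ⊎ (S ∈ X₂ × T ∈ X₂) → φ 3 D S ≡ φ 3 D T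
  from (inj₁ (S∈ , T∈)) = same-class (trans (on-X₁ S∈) (sym (on-X₁ T∈)))
  from (inj₂ (S∈ , T∈)) = same-class (trans (on-X₂ S∈) (sym (on-X₂ T∈)))

-- Part (i): the 3-sets

module Triples {v b r lam : ℕ} {D : List (Subset v)} (isd : IsBlockDesign v b r 3 lam D) where
  open IsBlockDesign isd

  isBlock? : (S : Subset v) → Dec (S ∈ D)
  isBlock? S = DecMembership._∈?_ _≟ₛ_ S D

  module Blocks = Class 3 isBlock?
  module NonBlocks = Class 3 (λ S → ¬? (isBlock? S))

  block-profile : ∀ {S} → S ∈ D → profile D S 3 ≡ 1
  block-profile S∈D = trans (triple-profile blockSize (All.lookup blockSize S∈D)) (occurrences-∈ _≟ₛ_ simple S∈D)

  non-block-profile : ∀ {S} → ∣ S ∣ ≡ 3 → S ∉ D → profile D S 3 ≡ 0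
  non-block-profile S≡3 S∉D = trans (triple-profile blockSize S≡3) (occurrences-∉ _≟ₛ_ _ D S∉D)

  classify : ∀ S → ∣ S ∣ ≡ 3 → (S ∈ D × profile D S 3 ≡ 1) ⊎ (S ∈ D3₂ D × profile D S 3 ≡ 0)
  classify S S≡3 with isBlock? S
  ... | yes S∈D = inj₁ (S∈D , block-profile S∈D)
  ... | no S∉D = inj₂ (NonBlocks.members⁺ S≡3 S∉D , non-block-profile S≡3 S∉D)

  fibres : ∀ S T → ∣ S ∣ ≡ 3 → ∣ T ∣ ≡ 3 →
    (φ 3 D S ≡ φ 3 D T ⇔ ((S ∈ D × T ∈ D) ⊎ (S ∈ D3₂ D × T ∈ D3₂ D)))
  fibres = two-fibres isd classify block-profile
    (λ S∈ → non-block-profile (proj₁ (NonBlocks.members⁻ S∈)) (proj₂ (NonBlocks.members⁻ S∈)))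

  partition : ∀ f → count f (D3₂ D) + count f D ≡ count (λ S → isSize 3 S ∧ f S) (allSubsets v)
  partition f = trans (cong (count f (D3₂ D) +_) blocks-as-3-sets) (Blocks.partition f)
    where
    open ≡-Reasoning
    blocks-as-3-sets : count f D ≡ count f (filter isBlock? (kSubsets v 3))
    blocks-as-3-sets = begin
      count f D
        ≡⟨ ∑-congᴬ (All.map (λ {B} B≡3 → cong (λ n → ⟦ does (n ≟ℕ 3) ∧ f B ⟧) (sym B≡3)) blockSize) ⟩
      count (λ S → isSize 3 S ∧ f S) D
        ≡⟨ sym (count-members _≟ₛ_ (allSubsets-unique v) allSubsets-complete _ D simple) ⟩
      count (λ S → does (isBlock? S) ∧ (isSize 3 S ∧ f S)) (allSubsets v)
        ≡⟨ ∑-cong (allSubsets v) (λ S → cong ⟦_⟧ (∧-swap (does (isBlock? S)) (isSize 3 S) (f S))) ⟩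
      count (λ S → isSize 3 S ∧ (does (isBlock? S) ∧ f S)) (allSubsets v)
        ≡⟨ sym (Blocks.count-class f) ⟩
      count f (filter isBlock? (kSubsets v 3)) ∎
      where
      ∧-swap : ∀ a b c → a ∧ (b ∧ c) ≡ b ∧ (a ∧ c)
      ∧-swap true b c = refl
      ∧-swap false b c = sym (∧-zeroʳ b)

  complement-design : IsDesign v 3 (D3₂ D)
  complement-design = regular-design NonBlocks.unique NonBlocks.sizes
    (complement-regular D (D3₂ D) partition (design-regular isd))

  self-friends : Friends 3 3 D D
  self-friends = on-blocks , on-blocks
    where
    on-blocks : ∀ B B′ → B ∈ D → B′ ∈ D → φ 3 D B ≡ φ 3 D B′
    on-blocks = φ-constant (b , r , lam , isd) (All.lookup blockSize) (λ {A} _ → meets-triples A blockSize) block-profile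

  complement-friends : Friends 3 3 D (D3₂ D)
  complement-friends =
    φ-constant (b , r , lam , isd) (λ A∈ → proj₁ (NonBlocks.members⁻ A∈)) (λ {A} _ → meets-triples A blockSize)
      (λ A∈ → non-block-profile (proj₁ (NonBlocks.members⁻ A∈)) (proj₂ (NonBlocks.members⁻ A∈))) ,
    φ-constant complement-design (All.lookup blockSize) (λ {A} _ → meets-triples A NonBlocks.sizes)
      (λ {A} A∈D → trans (triple-profile NonBlocks.sizes (All.lookup blockSize A∈D))
        (occurrences-∉ _≟ₛ_ A (D3₂ D) (λ A∈D3₂ → proj₂ (NonBlocks.members⁻ A∈D3₂) A∈D)))

-- Part (ii): the 4-sets, when lam = 1

no-pairs : ∀ m → m C 2 ≡ 0 → m ≤ 1
no-pairs 0 _ = z≤n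
no-pairs 1 _ = s≤s z≤n
no-pairs (suc (suc m)) e with trans (sym (pairs-suc (suc m))) e
... | ()

module Quadruples {v b r : ℕ} {D : List (Subset v)} (isd : IsBlockDesign v b r 3 1 D) where
  open IsBlockDesign isd

  -- Two distinct blocks share at most one point: M = B₁ ∩ B₂ lies in both blocks, so each
  -- of them contributes (|M| choose 2) to the second moment of M, which is 1 · (|M| choose 2).
  blocks-meet-once : ∀ {B₁ B₂} → B₁ ∈ D → B₂ ∈ D → B₁ ≢ B₂ → ∣ B₁ ∩ B₂ ∣ ≤ 1
  blocks-meet-once {B₁} {B₂} B₁∈D B₂∈D B₁≢B₂ =
    no-pairs ∣ M ∣ (n≤0⇒n≡0 (+-cancelˡ-≤ (∣ M ∣ C 2) (∣ M ∣ C 2) 0 (subst₂ _≤_ both-blocks moment two-terms)))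
    where
    M = B₁ ∩ B₂
    two-terms : ∣ M ∩ B₁ ∣ C 2 + ∣ M ∩ B₂ ∣ C 2 ≤ ∑[ B ← D ] (∣ M ∩ B ∣ C 2)
    two-terms = ∑-two-members (λ B → ∣ M ∩ B ∣ C 2) D B₁∈D B₂∈D B₁≢B₂
    inside₁ : M ∩ B₁ ≡ M
    inside₁ = trans (∩-assoc B₁ B₂ B₁) (trans (cong (B₁ ∩_) (∩-comm B₂ B₁))
      (trans (sym (∩-assoc B₁ B₁ B₂)) (cong (_∩ B₂) (∩-idem B₁))))
    inside₂ : M ∩ B₂ ≡ M
    inside₂ = trans (∩-assoc B₁ B₂ B₂) (cong (B₁ ∩_) (∩-idem B₂))
    both-blocks : ∣ M ∩ B₁ ∣ C 2 + ∣ M ∩ B₂ ∣ C 2 ≡ ∣ M ∣ C 2 + ∣ M ∣ C 2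
    both-blocks = cong₂ (λ X Y → ∣ X ∣ C 2 + ∣ Y ∣ C 2) inside₁ inside₂
    moment : ∑[ B ← D ] (∣ M ∩ B ∣ C 2) ≡ ∣ M ∣ C 2 + 0
    moment = second-moment D (design-balanced isd) M

  -- Hence a 4-set contains at most one block: two blocks in it would span ≥ 3 + 3 - 1 points.
  one-block-per-quad : ∀ {T B₁ B₂} → ∣ T ∣ ≡ 4 → B₁ ∈ D → B₂ ∈ D → B₁ ⊆ T → B₂ ⊆ T → B₁ ≡ B₂
  one-block-per-quad {T} {B₁} {B₂} T≡4 B₁∈D B₂∈D B₁⊆T B₂⊆T with B₁ ≟ₛ B₂
  ... | yes B₁≡B₂ = B₁≡B₂
  ... | no B₁≢B₂ = ⊥-elim (<⇒≱ (s≤s ≤-refl) (begin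
    6                            ≡⟨ sym (cong₂ _+_ (All.lookup blockSize B₁∈D) (All.lookup blockSize B₂∈D)) ⟩
    ∣ B₁ ∣ + ∣ B₂ ∣              ≡⟨ sym (∣∪∣+∣∩∣ B₁ B₂) ⟩
    ∣ B₁ ∪ B₂ ∣ + ∣ B₁ ∩ B₂ ∣    ≤⟨ +-mono-≤ union-in-T (blocks-meet-once B₁∈D B₂∈D B₁≢B₂) ⟩
    4 + 1 ∎))
    where
    open ≤-Reasoning
    union-in-T : ∣ B₁ ∪ B₂ ∣ ≤ 4
    union-in-T = subst (∣ B₁ ∪ B₂ ∣ ≤_) T≡4 (⊆ᵇ-size {p = B₁ ∪ B₂} {T} (trans (⊆ᵇ-∪ B₁ B₂ T)
      (cong₂ _∧_ (dec-true (B₁ ⊆? T) B₁⊆T) (dec-true (B₂ ⊆? T) B₂⊆T))))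

  hasBlock? : (T : Subset v) → Dec (Any (_⊆ T) D)
  hasBlock? T = any? (λ B → B ⊆? T) D

  module WithBlock = Class 4 hasBlock?
  module WithoutBlock = Class 4 (λ T → ¬? (hasBlock? T))

  quad-profile : ∀ {T} → ∣ T ∣ ≡ 4 → profile D T 3 ≡ ⟦ does (hasBlock? T) ⟧
  quad-profile {T} T≡4 = trans (∑-congᴬ (All.map (λ {B} B≡3 → cong ⟦_⟧ (meets-whole T B B≡3)) blockSize))
    (count-at-most-one (λ B → B ⊆? T) D simple (one-block-per-quad T≡4))

  classify : ∀ T → ∣ T ∣ ≡ 4 → (T ∈ D4₁ D × profile D T 3 ≡ 1) ⊎ (T ∈ D4₂ D × profile D T 3 ≡ 0)
  classify T T≡4 with hasBlock? T in decision
  ... | yes has = inj₁ (WithBlock.members⁺ T≡4 has , trans (quad-profile T≡4) (cong (λ d → ⟦ does d ⟧) decision))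
  ... | no hasn't = inj₂ (WithoutBlock.members⁺ T≡4 hasn't , trans (quad-profile T≡4) (cong (λ d → ⟦ does d ⟧) decision))

  on-D4₁ : ∀ {T} → T ∈ D4₁ D → profile D T 3 ≡ 1
  on-D4₁ T∈ with WithBlock.members⁻ T∈
  ... | T≡4 , has = trans (quad-profile T≡4) (cong ⟦_⟧ (dec-true (hasBlock? _) has))

  on-D4₂ : ∀ {T} → T ∈ D4₂ D → profile D T 3 ≡ 0
  on-D4₂ T∈ with WithoutBlock.members⁻ T∈
  ... | T≡4 , hasn't = trans (quad-profile T≡4) (cong ⟦_⟧ (dec-false (hasBlock? _) hasn't))

  fibres : ∀ S T → ∣ S ∣ ≡ 4 → ∣ T ∣ ≡ 4 →
    (φ 3 D S ≡ φ 3 D T ⇔ ((S ∈ D4₁ D × T ∈ D4₁ D) ⊎ (S ∈ D4₂ D × T ∈ D4₂ D)))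
  fibres = two-fibres isd classify on-D4₁ on-D4₂

  -- Each 4-set containing P ∪ B for a block B is counted once, as it contains no other block.
  through-D4₁ : ∀ P → through (D4₁ D) P ≡ ∑[ B ← D ] supersetCount v 4 ∣ B ∪ P ∣
  through-D4₁ P = begin
    through (D4₁ D) P
      ≡⟨ WithBlock.count-class (P ⊆ᵇ_) ⟩
    count (λ T → isSize 4 T ∧ (does (hasBlock? T) ∧ P ⊆ᵇ T)) (allSubsets v)
      ≡⟨ ∑-cong (allSubsets v) (λ T → cong ⟦_⟧ (shuffle (isSize 4 T) (does (hasBlock? T)) (P ⊆ᵇ T))) ⟩
    count (λ T → (isSize 4 T ∧ P ⊆ᵇ T) ∧ does (hasBlock? T)) (allSubsets v)
      ≡⟨ count-any (λ T → isSize 4 T ∧ P ⊆ᵇ T) (λ B T → B ⊆? T) D (allSubsets v) simple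
           (λ T quad → one-block-per-quad (holds (∣ T ∣ ≟ℕ 4) (∧-trueˡ quad))) ⟩
    ∑[ B ← D ] count (λ T → (isSize 4 T ∧ P ⊆ᵇ T) ∧ B ⊆ᵇ T) (allSubsets v)
      ≡⟨ ∑-cong D (λ B → ∑-cong (allSubsets v) (λ T → cong ⟦_⟧ (union B T))) ⟩
    ∑[ B ← D ] count (λ T → isSize 4 T ∧ (B ∪ P) ⊆ᵇ T) (allSubsets v)
      ≡⟨ ∑-cong D (λ B → supersets 4 (B ∪ P)) ⟩
    ∑[ B ← D ] supersetCount v 4 ∣ B ∪ P ∣ ∎
    where
    open ≡-Reasoning
    shuffle : ∀ a b c → a ∧ (b ∧ c) ≡ (a ∧ c) ∧ b
    shuffle a b c = trans (cong (a ∧_) (∧-comm b c)) (sym (∧-assoc a c b))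
    ∧-trueˡ : ∀ {a b} → a ∧ b ≡ true → a ≡ true
    ∧-trueˡ {true} _ = refl
    union : ∀ B T → (isSize 4 T ∧ P ⊆ᵇ T) ∧ B ⊆ᵇ T ≡ isSize 4 T ∧ (B ∪ P) ⊆ᵇ T
    union B T = trans (sym (shuffle (isSize 4 T) (B ⊆ᵇ T) (P ⊆ᵇ T))) (cong (isSize 4 T ∧_) (sym (⊆ᵇ-∪ B P T)))

  -- |B ∪ P| = 3 + |P| - |P ∩ B|, so the count through P only depends on the profile of P,
  -- which for |P| ≤ 2 only depends on |P|.
  D4₁-regular : Regular (D4₁ D)
  D4₁-regular P Q P≡Q P≤2 = begin
    through (D4₁ D) P                            ≡⟨ by-profile P P≤2 ⟩
    weigh (extensions ∣ P ∣) (profile D P)        ≡⟨ weigh-cong (extensions ∣ P ∣) (small-profiles isd {P} {Q} P≡Q P≤2) ⟩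
    weigh (extensions ∣ P ∣) (profile D Q)        ≡⟨ cong (λ p → weigh (extensions p) (profile D Q)) P≡Q ⟩
    weigh (extensions ∣ Q ∣) (profile D Q)        ≡⟨ sym (by-profile Q (subst (_≤ 2) P≡Q P≤2)) ⟩
    through (D4₁ D) Q ∎
    where
    open ≡-Reasoning
    extensions : ℕ → ℕ → ℕ
    extensions p j = supersetCount v 4 (3 + p ∸ j)
    union-size : ∀ S B → ∣ B ∣ ≡ 3 → ∣ B ∪ S ∣ ≡ 3 + ∣ S ∣ ∸ ∣ S ∩ B ∣
    union-size S B B≡3 = trans (sym (m+n∸n≡m ∣ B ∪ S ∣ ∣ B ∩ S ∣))
      (cong₂ _∸_ (trans (∣∪∣+∣∩∣ B S) (cong (_+ ∣ S ∣) B≡3)) (cong ∣_∣ (∩-comm B S)))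
    by-profile : ∀ S → ∣ S ∣ ≤ 2 → through (D4₁ D) S ≡ weigh (extensions ∣ S ∣) (profile D S)
    by-profile S S≤2 = trans (through-D4₁ S) (trans
      (∑-congᴬ (All.map (λ {B} B≡3 → cong (supersetCount v 4) (union-size S B B≡3)) blockSize))
      (∑-by-levels _ (extensions ∣ S ∣) D (meets-small-set D S (≤-trans S≤2 (n≤1+n 2)))))

  D4₁-design : IsDesign v 4 (D4₁ D)
  D4₁-design = regular-design WithBlock.unique WithBlock.sizes D4₁-regular

  D4₂-design : IsDesign v 4 (D4₂ D)
  D4₂-design = regular-design WithoutBlock.unique WithoutBlock.sizes
    (complement-regular (D4₁ D) (D4₂ D) WithBlock.partition D4₁-regular)

  through-block : ∀ {A} → A ∈ D → ∀ T → A ⊆ᵇ T ≡ true → does (hasBlock? T) ≡ true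
  through-block A∈D T A⊆T = dec-true (hasBlock? T) (lose A∈D (holds (_ ⊆? T) A⊆T))

  block-profile₁ : ∀ {A} → A ∈ D → profile (D4₁ D) A 3 ≡ supersetCount v 4 3
  block-profile₁ {A} A∈D = begin
    profile (D4₁ D) A 3
      ≡⟨ cong (profile (D4₁ D) A) (sym A≡3) ⟩
    profile (D4₁ D) A ∣ A ∣
      ≡⟨ sym (through-profile (D4₁ D) A) ⟩
    through (D4₁ D) A
      ≡⟨ WithBlock.count-class (A ⊆ᵇ_) ⟩
    count (λ T → isSize 4 T ∧ (does (hasBlock? T) ∧ A ⊆ᵇ T)) (allSubsets v)
      ≡⟨ ∑-cong (allSubsets v) (λ T → cong (λ c → ⟦ isSize 4 T ∧ c ⟧) (absorb T)) ⟩
    count (λ T → isSize 4 T ∧ A ⊆ᵇ T) (allSubsets v)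
      ≡⟨ supersets 4 A ⟩
    supersetCount v 4 ∣ A ∣
      ≡⟨ cong (supersetCount v 4) A≡3 ⟩
    supersetCount v 4 3 ∎
    where
    open ≡-Reasoning
    A≡3 : ∣ A ∣ ≡ 3
    A≡3 = All.lookup blockSize A∈D
    absorb : ∀ T → does (hasBlock? T) ∧ A ⊆ᵇ T ≡ A ⊆ᵇ T
    absorb T with A ⊆ᵇ T in A⊆T
    ... | true = cong (_∧ true) (through-block A∈D T A⊆T)
    ... | false = ∧-zeroʳ _

  block-profile₂ : ∀ {A} → A ∈ D → profile (D4₂ D) A 3 ≡ 0
  block-profile₂ {A} A∈D = begin
    profile (D4₂ D) A 3
      ≡⟨ cong (profile (D4₂ D) A) (sym A≡3) ⟩
    profile (D4₂ D) A ∣ A ∣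
      ≡⟨ sym (through-profile (D4₂ D) A) ⟩
    through (D4₂ D) A
      ≡⟨ WithoutBlock.count-class (A ⊆ᵇ_) ⟩
    count (λ T → isSize 4 T ∧ (not (does (hasBlock? T)) ∧ A ⊆ᵇ T)) (allSubsets v)
      ≡⟨ count-none _ (allSubsets v) (λ T _ → trans (cong (isSize 4 T ∧_) (excluded T)) (∧-zeroʳ (isSize 4 T))) ⟩
    0 ∎
    where
    open ≡-Reasoning
    A≡3 : ∣ A ∣ ≡ 3
    A≡3 = All.lookup blockSize A∈D
    excluded : ∀ T → not (does (hasBlock? T)) ∧ A ⊆ᵇ T ≡ false
    excluded T with A ⊆ᵇ T in A⊆T
    ... | true = cong (λ c → not c ∧ true) (through-block A∈D T A⊆T)
    ... | false = ∧-zeroʳ _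

  friends₁ : Friends 3 4 D (D4₁ D)
  friends₁ =
    φ-constant (b , r , 1 , isd) (λ T∈ → proj₁ (WithBlock.members⁻ T∈)) (λ {T} _ → meets-triples T blockSize) on-D4₁ ,
    φ-constant D4₁-design (All.lookup blockSize)
      (λ {A} A∈D → meets-small-set (D4₁ D) A (≤-reflexive (All.lookup blockSize A∈D))) block-profile₁

  friends₂ : Friends 3 4 D (D4₂ D)
  friends₂ =
    φ-constant (b , r , 1 , isd) (λ T∈ → proj₁ (WithoutBlock.members⁻ T∈)) (λ {T} _ → meets-triples T blockSize) on-D4₂ ,
    φ-constant D4₂-design (All.lookup blockSize)
      (λ {A} A∈D → meets-small-set (D4₂ D) A (≤-reflexive (All.lookup blockSize A∈D))) block-profile₂

theorem2 : ∀ (v b r lam : ℕ) (D : List (Subset v)) → IsBlockDesign v b r 3 lam D →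
    ((∀ (S T : Subset v) → ∣ S ∣ ≡ 3 → ∣ T ∣ ≡ 3 →
        (φ 3 D S ≡ φ 3 D T ⇔ ((S ∈ D × T ∈ D) ⊎ (S ∈ D3₂ D × T ∈ D3₂ D))))
     × IsDesign v 3 D × IsDesign v 3 (D3₂ D)
     × Friends 3 3 D D × Friends 3 3 D (D3₂ D))
    ×
    (lam ≡ 1 →
      (∀ (S T : Subset v) → ∣ S ∣ ≡ 4 → ∣ T ∣ ≡ 4 →
        (φ 3 D S ≡ φ 3 D T ⇔ ((S ∈ D4₁ D × T ∈ D4₁ D) ⊎ (S ∈ D4₂ D × T ∈ D4₂ D))))
      × IsDesign v 4 (D4₁ D) × IsDesign v 4 (D4₂ D)
      × Friends 3 4 D (D4₁ D) × Friends 3 4 D (D4₂ D))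
theorem2 v b r lam D isd =
  ( Triples.fibres isd , (b , r , lam , isd) , Triples.complement-design isd
  , Triples.self-friends isd , Triples.complement-friends isd ) ,
  λ { refl → Quadruples.fibres isd , Quadruples.D4₁-design isd , Quadruples.D4₂-design isd
           , Quadruples.friends₁ isd , Quadruples.friends₂ isd }
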